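{- Let $A, B \in \Gamma_\theta$ and write $A = \begin{pmatrix} * & * \\ c_A & *\end{pmatrix}$, $B = \begin{pmatrix} * & * \\ c_B & *\end{pmatrix}$, $AB = \begin{pmatrix} * & * \\ c_{AB} & *\end{pmatrix}$. Then $$\mathfrak{S}(AB) - \mathfrak{S}(A) - \mathfrak{S}(B) = -\mathrm{sign}(c_A c_B c_{AB}).$$
   Context: $\Gamma_\theta = \{\begin{pmatrix} a&b\\c&d\end{pmatrix}\in \mathrm{SL}_2(\mathbf{Z}) : a\equiv d,\ b\equiv c \pmod 2\}$. For $A=\begin{pmatrix} a&b\\c&d\end{pmatrix}\in\Gamma_\theta$, $\mathfrak{S}(A)=\sum_{k=1}^{|c|-1}(-1)^{\lfloor ka/c\rfloor+k+1}$ if $c\neq 0$, and $\mathfrak{S}(A)=0$ if $c=0$. The sign function satisfies $\mathrm{sign}(0)=0$. -}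

module Defs where

open import Data.Nat as ℕ using (ℕ; zero; suc)
open import Data.Integer hiding (suc)
open import Data.Integer.Divisibility using (_∣_)
open import Data.List using (List; []; _∷_; upTo; map)
open import Data.Product using (_×_)
open import Relation.Binary.PropositionalEquality using (_≡_)

record M2 : Set where
  constructor mat
  field
    a b c d : ℤ
open M2 public

_⊗_ : M2 → M2 → M2
mat a₁ b₁ c₁ d₁ ⊗ mat a₂ b₂ c₂ d₂ =
  mat (a₁ * a₂ + b₁ * c₂) (a₁ * b₂ + b₁ * d₂)
      (c₁ * a₂ + d₁ * c₂) (c₁ * b₂ + d₁ * d₂)

InΓθ : M2 → Set
InΓθ (mat a b c d) = (a * d - b * c ≡ 1ℤ) × ((+ 2) ∣ (a - d)) × ((+ 2) ∣ (b - c))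

sumℤ : List ℤ → ℤ
sumℤ [] = 0ℤ
sumℤ (x ∷ xs) = x + sumℤ xs

negOnePow : ℤ → ℤ
negOnePow n with ∣ n ∣ ℕ.% 2
... | zero  = 1ℤ
... | suc _ = -1ℤ

-- floor (n / suc m) and floor (n / -(suc m))
floorDivPos : ℤ → ℕ → ℤ
floorDivPos n m = n /ℕ suc m

floorDivNeg : ℤ → ℕ → ℤ
floorDivNeg n m = (- n) /ℕ suc m

-- 𝔖(A) = Σ_{k=1}^{|c|-1} (-1)^{⌊k a / c⌋ + k + 1}, and 0 if c = 0
𝔖 : M2 → ℤ
𝔖 (mat a b (+ zero) d) = 0ℤ
𝔖 (mat a b (+ suc m) d) =
  sumℤ (map (λ j → let k = + suc j in negOnePow (floorDivPos (k * a) m + k + 1ℤ)) (upTo m))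
𝔖 (mat a b -[1+ m ] d) =
  sumℤ (map (λ j → let k = + suc j in negOnePow (floorDivNeg (k * a) m + k + 1ℤ)) (upTo m))

sgn : ℤ → ℤ
sgn (+ zero) = 0ℤ
sgn (+ suc _) = 1ℤ
sgn -[1+ _ ] = -1ℤ

-- Γθ consists of the determinant-one matrices whose columns have odd entry sums, and 𝔖 only
-- depends on the first column (a, c). It is unchanged by a ↦ a + 2tc and by (a, c) ↦ (-a, -c),
-- and for coprime a, c of opposite parity it satisfies the reciprocity law
-- 𝔖(a, c) + 𝔖(c, a) = sgn (a c), a lattice-point count. Hence replacing A by T^{2t} A changes
-- neither side of the identity, while replacing A by S A (S = (0 1 ; -1 0)) changes both sides
-- by amounts whose agreement is an identity between signs, checked on all sign patterns.
-- Since |a + 2tc| < |c| for a suitable t (a + c being odd), these moves lower |c_A| until c_A = 0, where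
-- A = ±T^{2s} and both sides vanish.

module Submission where

open import Defs
open import Data.Empty using (⊥-elim)
open import Data.Integer
  using (ℤ; _+_; _-_; _*_; -_; +_; -[1+_]; ∣_∣; 0ℤ; 1ℤ; -1ℤ; _/ℕ_; _%ℕ_; _≤_; _<_; _⊖_)
  renaming (suc to sucℤ)
open import Data.Integer.Coprimality using (Coprime)
open import Data.Integer.DivMod using (n%ℕd<d; a≡a%ℕn+[a/ℕn]*n; [n/ℕd]*d≤n; n<s[n/ℕd]*d)
import Data.Integer.Divisibility.Signed as ℤD
open import Data.Integer.Properties
open import Data.Integer.Tactic.RingSolver using (solve-∀)
open import Data.List using (List; []; _∷_; map; applyUpTo)
open import Data.List.Membership.Propositional using (_∈_)
open import Data.List.Relation.Unary.All using (All; all?; lookup)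
open import Data.List.Relation.Unary.Any using (here; there)
open import Data.Nat as ℕ using (ℕ; zero; suc; z≤n; s≤s)
import Data.Nat.Coprimality as ℕC
open import Data.Nat.Divisibility using (divides; ∣⇒≤; ∣1⇒≡1; _∣0; ∣-refl)
import Data.Nat.DivMod as ℕD
import Data.Nat.Properties as ℕₚ
open import Data.Product using (_×_; _,_; ∃-syntax)
open import Data.Sum using (_⊎_; inj₁; inj₂)
open import Function using (_∘_)
open import Relation.Binary.PropositionalEquality
open import Relation.Nullary using (¬_; yes; no)
open import Relation.Nullary.Decidable using (Dec; from-yes; ¬?; _×-dec_; _⊎-dec_; _→-dec_)

-- Parity

σ : ℕ → ℤ
σ n = negOnePow (+ n)

σ-suc : ∀ n → σ (suc n) ≡ - σ n
σ-suc zero          = refl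
σ-suc (suc zero)    = refl
σ-suc (suc (suc n)) = σ-suc n

negOnePow-+1 : ∀ x → negOnePow (x + 1ℤ) ≡ - negOnePow x
negOnePow-+1 (+ n)            = trans (cong σ (ℕₚ.+-comm n 1)) (σ-suc n)
negOnePow-+1 -[1+ zero ]      = refl
negOnePow-+1 -[1+ suc n ]     = σ-suc n

negOnePow-+ : ∀ x y → negOnePow (x + y) ≡ negOnePow x * negOnePow y
negOnePow-+ x (+ zero) =
  trans (cong negOnePow (+-identityʳ x)) (sym (*-identityʳ (negOnePow x)))
negOnePow-+ x (+ suc n) = begin
  negOnePow (x + + suc n)        ≡⟨ cong (λ k → negOnePow (x + + k)) (ℕₚ.+-comm 1 n) ⟩
  negOnePow (x + (+ n + 1ℤ))     ≡⟨ cong negOnePow (sym (+-assoc x (+ n) 1ℤ)) ⟩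
  negOnePow (x + + n + 1ℤ)       ≡⟨ negOnePow-+1 (x + + n) ⟩
  - negOnePow (x + + n)          ≡⟨ cong -_ (negOnePow-+ x (+ n)) ⟩
  - (negOnePow x * σ n)          ≡⟨ neg-distribʳ-* (negOnePow x) (σ n) ⟩
  negOnePow x * - σ n            ≡⟨ cong (negOnePow x *_) (sym (σ-suc n)) ⟩
  negOnePow x * σ (suc n)        ∎
  where open ≡-Reasoning
negOnePow-+ x -[1+ n ] = begin
  negOnePow (x + -[1+ n ])                 ≡⟨ sym (neg-involutive _) ⟩
  - - negOnePow (x + -[1+ n ])             ≡⟨ cong -_ (sym (negOnePow-+1 (x + -[1+ n ]))) ⟩
  - negOnePow (x + -[1+ n ] + 1ℤ)          ≡⟨ cong (λ y → - negOnePow y) (+-assoc x -[1+ n ] 1ℤ) ⟩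
  - negOnePow (x + (-[1+ n ] + 1ℤ))        ≡⟨ cong -_ (shorter n) ⟩
  - (negOnePow x * σ n)                    ≡⟨ neg-distribʳ-* (negOnePow x) (σ n) ⟩
  negOnePow x * - σ n                      ≡⟨ cong (negOnePow x *_) (sym (σ-suc n)) ⟩
  negOnePow x * σ (suc n)                  ∎
  where
  open ≡-Reasoning
  shorter : ∀ n → negOnePow (x + (-[1+ n ] + 1ℤ)) ≡ negOnePow x * σ n
  shorter zero    = negOnePow-+ x (+ zero)
  shorter (suc n) = negOnePow-+ x -[1+ n ]

negOnePow-neg : ∀ x → negOnePow (- x) ≡ negOnePow x
negOnePow-neg x = cong σ (∣-i∣≡∣i∣ x)

negOnePow-+-∣∣ : ∀ x y x′ y′ → ∣ x ∣ ≡ ∣ x′ ∣ → ∣ y ∣ ≡ ∣ y′ ∣ → negOnePow (x + y) ≡ negOnePow (x′ + y′)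
negOnePow-+-∣∣ x y x′ y′ ∣x∣≡ ∣y∣≡ = begin
  negOnePow (x + y)               ≡⟨ negOnePow-+ x y ⟩
  σ ∣ x ∣ * σ ∣ y ∣               ≡⟨ cong₂ (λ m n → σ m * σ n) ∣x∣≡ ∣y∣≡ ⟩
  σ ∣ x′ ∣ * σ ∣ y′ ∣             ≡⟨ negOnePow-+ x′ y′ ⟨
  negOnePow (x′ + y′)             ∎
  where open ≡-Reasoning

σ-square : ∀ n → σ n * σ n ≡ 1ℤ
σ-square zero          = refl
σ-square (suc zero)    = refl
σ-square (suc (suc n)) = σ-square n

negOnePow-double : ∀ x → negOnePow (x + x) ≡ 1ℤ
negOnePow-double x = trans (negOnePow-+ x x) (σ-square ∣ x ∣)

negOnePow-+-double : ∀ x s → negOnePow (x + (s + s)) ≡ negOnePow x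
negOnePow-+-double x s =
  trans (negOnePow-+ x (s + s)) (trans (cong (negOnePow x *_) (negOnePow-double s)) (*-identityʳ _))

Odd : ℤ → Set
Odd x = negOnePow x ≡ -1ℤ

odd-1+double : ∀ s → Odd (1ℤ + (s + s))
odd-1+double s = negOnePow-+-double 1ℤ s

double-not-odd : ∀ s → ¬ Odd (s + s)
double-not-odd s odd with () ← trans (sym (negOnePow-double s)) odd

parity : ∀ x → (∃[ s ] x ≡ s + s) ⊎ (∃[ s ] x ≡ 1ℤ + (s + s))
parity x with x %ℕ 2 | n%ℕd<d x 2 | a≡a%ℕn+[a/ℕn]*n x 2
... | 0 | _             | x≡ = inj₁ (x /ℕ 2 , trans x≡ (even (x /ℕ 2)))
  where
  even : ∀ q → 0ℤ + q * + 2 ≡ q + q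
  even = solve-∀
... | 1 | _             | x≡ = inj₂ (x /ℕ 2 , trans x≡ (odd (x /ℕ 2)))
  where
  odd : ∀ q → 1ℤ + q * + 2 ≡ 1ℤ + (q + q)
  odd = solve-∀
... | suc (suc _) | s≤s (s≤s ()) | _

even-half : ∀ x → negOnePow x ≡ 1ℤ → ∃[ s ] x ≡ s + s
even-half x even with parity x
... | inj₁ half       = half
... | inj₂ (s , refl) with trans (sym even) (odd-1+double s)
...   | ()

odd-half : ∀ x → Odd x → ∃[ s ] x ≡ 1ℤ + (s + s)
odd-half x odd with parity x
... | inj₂ half       = half
... | inj₁ (s , refl) = ⊥-elim (double-not-odd s odd)

negOnePow-*-odd : ∀ p y → Odd p → negOnePow (p * y) ≡ negOnePow y
negOnePow-*-odd p y odd with odd-half p odd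
... | s , refl = trans (cong negOnePow (expand s y)) (negOnePow-+-double y (s * y))
  where
  expand : ∀ s y → (1ℤ + (s + s)) * y ≡ y + (s * y + s * y)
  expand = solve-∀

negOnePow-square : ∀ x → negOnePow (x * x) ≡ negOnePow x
negOnePow-square x with parity x
... | inj₂ (s , refl) = negOnePow-*-odd (1ℤ + (s + s)) _ (odd-1+double s)
... | inj₁ (s , refl) = trans (cong negOnePow (expand s)) (trans (negOnePow-double (s * (s + s)))
                                                                (sym (negOnePow-double s)))
  where
  expand : ∀ s → (s + s) * (s + s) ≡ s * (s + s) + s * (s + s)
  expand = solve-∀

odd-combination : ∀ p q x y → Odd p → Odd q → Odd (x + y) → Odd (p * x + q * y)
odd-combination p q x y odd-p odd-q odd-x+y = begin
  negOnePow (p * x + q * y)                   ≡⟨ negOnePow-+ (p * x) (q * y) ⟩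
  negOnePow (p * x) * negOnePow (q * y)       ≡⟨ cong₂ _*_ (negOnePow-*-odd p x odd-p) (negOnePow-*-odd q y odd-q) ⟩
  negOnePow x * negOnePow y                   ≡⟨ negOnePow-+ x y ⟨
  negOnePow (x + y)                           ≡⟨ odd-x+y ⟩
  -1ℤ                                         ∎
  where open ≡-Reasoning

-- Signs

sgn-neg : ∀ x → sgn (- x) ≡ - sgn x
sgn-neg (+ zero)  = refl
sgn-neg (+ suc n) = refl
sgn-neg -[1+ n ]  = refl

sgn-* : ∀ x y → sgn (x * y) ≡ sgn x * sgn y
sgn-* (+ zero)  y         = refl
sgn-* (+ suc m) (+ zero)  = cong sgn (*-zeroʳ (+ suc m))
sgn-* (+ suc m) (+ suc n) = refl
sgn-* (+ suc m) -[1+ n ]  = refl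
sgn-* -[1+ m ]  (+ zero)  = cong sgn (*-zeroʳ -[1+ m ])
sgn-* -[1+ m ]  (+ suc n) = refl
sgn-* -[1+ m ]  -[1+ n ]  = refl

sgn≡0⇒≡0 : ∀ x → sgn x ≡ 0ℤ → x ≡ 0ℤ
sgn≡0⇒≡0 (+ zero) _ = refl

sgn-− : ∀ x y → (sgn x ≡ sgn y × sgn x ≢ 0ℤ) ⊎ sgn (x - y) ≡ sgn (sgn x - sgn y)
sgn-− (+ zero)  (+ zero)  = inj₂ refl
sgn-− (+ zero)  (+ suc n) = inj₂ refl
sgn-− (+ zero)  -[1+ n ]  = inj₂ refl
sgn-− (+ suc m) (+ zero)  = inj₂ refl
sgn-− (+ suc m) (+ suc n) = inj₁ (refl , λ ())
sgn-− (+ suc m) -[1+ n ]  = inj₂ refl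
sgn-− -[1+ m ]  (+ zero)  = inj₂ refl
sgn-− -[1+ m ]  (+ suc n) = inj₂ refl
sgn-− -[1+ m ]  -[1+ n ]  = inj₁ (refl , λ ())

signs : List ℤ
signs = -1ℤ ∷ 0ℤ ∷ 1ℤ ∷ []

sgn∈signs : ∀ x → sgn x ∈ signs
sgn∈signs -[1+ n ]  = here refl
sgn∈signs (+ zero)  = there (here refl)
sgn∈signs (+ suc n) = there (there (here refl))

NonZeroVec : ℤ → ℤ → Set
NonZeroVec x y = ¬ (x ≡ 0ℤ × y ≡ 0ℤ)

-- The sign cocycle identity with every quantity replaced by its sign; δ stands for the sign of
-- α γ′ - γ α′, which the signs determine except when α γ′ and γ α′ share a nonzero sign.
SignCocycle : ℤ → ℤ → ℤ → ℤ → ℤ → Set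
SignCocycle α γ α′ γ′ δ = NonZeroVec α γ → NonZeroVec α′ γ′ →
  (α * γ′ ≡ γ * α′ × α * γ′ ≢ 0ℤ) ⊎ δ ≡ sgn (α * γ′ - γ * α′) →
  α * α′ * δ - γ * γ′ * δ ≡ α′ * γ′ - α * γ

signCocycle? : ∀ α γ α′ γ′ δ → Dec (SignCocycle α γ α′ γ′ δ)
signCocycle? α γ α′ γ′ δ =
  ¬? ((α ≟ 0ℤ) ×-dec (γ ≟ 0ℤ)) →-dec ¬? ((α′ ≟ 0ℤ) ×-dec (γ′ ≟ 0ℤ)) →-dec
  (((α * γ′ ≟ γ * α′) ×-dec ¬? (α * γ′ ≟ 0ℤ)) ⊎-dec (δ ≟ sgn (α * γ′ - γ * α′))) →-dec
  (α * α′ * δ - γ * γ′ * δ ≟ α′ * γ′ - α * γ)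

signCocycle-table : All (λ α → All (λ γ → All (λ α′ → All (λ γ′ →
                      All (SignCocycle α γ α′ γ′) signs) signs) signs) signs) signs
signCocycle-table = from-yes (all? (λ α → all? (λ γ → all? (λ α′ → all? (λ γ′ →
                      all? (signCocycle? α γ α′ γ′) signs) signs) signs) signs) signs)

sgn-cocycle : ∀ a c a′ c′ → NonZeroVec a c → NonZeroVec a′ c′ →
  let D = a * c′ - c * a′ in sgn (a * a′ * D) - sgn (c * c′ * D) ≡ sgn (a′ * c′) - sgn (a * c)
sgn-cocycle a c a′ c′ nz nz′ = begin
  sgn (a * a′ * D) - sgn (c * c′ * D)             ≡⟨ cong₂ _-_ (sgn-*³ a a′ D) (sgn-*³ c c′ D) ⟩
  sgn a * sgn a′ * sgn D - sgn c * sgn c′ * sgn D  ≡⟨ table-entry (sgn-nonZero nz) (sgn-nonZero nz′) sgn-D ⟩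
  sgn a′ * sgn c′ - sgn a * sgn c                  ≡⟨ cong₂ _-_ (sgn-* a′ c′) (sgn-* a c) ⟨
  sgn (a′ * c′) - sgn (a * c)                      ∎
  where
  open ≡-Reasoning
  D = a * c′ - c * a′
  sgn-*³ : ∀ x y z → sgn (x * y * z) ≡ sgn x * sgn y * sgn z
  sgn-*³ x y z = trans (sgn-* (x * y) z) (cong (_* sgn z) (sgn-* x y))
  sgn-nonZero : ∀ {x y} → NonZeroVec x y → NonZeroVec (sgn x) (sgn y)
  sgn-nonZero {x} {y} nz (x≡0 , y≡0) = nz (sgn≡0⇒≡0 x x≡0 , sgn≡0⇒≡0 y y≡0)
  table-entry : SignCocycle (sgn a) (sgn c) (sgn a′) (sgn c′) (sgn D)
  table-entry = lookup (lookup (lookup (lookup (lookup signCocycle-table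
    (sgn∈signs a)) (sgn∈signs c)) (sgn∈signs a′)) (sgn∈signs c′)) (sgn∈signs D)
  sgn-D : (sgn a * sgn c′ ≡ sgn c * sgn a′ × sgn a * sgn c′ ≢ 0ℤ) ⊎ sgn D ≡ sgn (sgn a * sgn c′ - sgn c * sgn a′)
  sgn-D with sgn-− (a * c′) (c * a′)
  ... | inj₁ (same , nonzero) = inj₁ ( trans (sym (sgn-* a c′)) (trans same (sgn-* c a′))
                                     , λ eq → nonzero (trans (sgn-* a c′) eq))
  ... | inj₂ determined       = inj₂ (trans determined (cong₂ (λ x y → sgn (x - y)) (sgn-* a c′) (sgn-* c a′)))

-- Finite sums and floor division

∑< : ℕ → (ℕ → ℤ) → ℤ
∑< zero    f = 0ℤ
∑< (suc n) f = ∑< n f + f n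

∑<-cons : ∀ n f → ∑< (suc n) f ≡ f 0 + ∑< n (f ∘ suc)
∑<-cons zero    f = trans (+-identityˡ (f 0)) (sym (+-identityʳ (f 0)))
∑<-cons (suc n) f = trans (cong (_+ f (suc n)) (∑<-cons n f)) (+-assoc (f 0) _ _)

∑<-+ : ∀ m n f → ∑< (m ℕ.+ n) f ≡ ∑< m f + ∑< n (λ i → f (m ℕ.+ i))
∑<-+ m zero    f = trans (cong (λ k → ∑< k f) (ℕₚ.+-identityʳ m)) (sym (+-identityʳ _))
∑<-+ m (suc n) f = begin
  ∑< (m ℕ.+ suc n) f                                    ≡⟨ cong (λ k → ∑< k f) (ℕₚ.+-suc m n) ⟩
  ∑< (m ℕ.+ n) f + f (m ℕ.+ n)                          ≡⟨ cong (_+ f (m ℕ.+ n)) (∑<-+ m n f) ⟩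
  ∑< m f + ∑< n (λ i → f (m ℕ.+ i)) + f (m ℕ.+ n)       ≡⟨ +-assoc (∑< m f) _ _ ⟩
  ∑< m f + ∑< (suc n) (λ i → f (m ℕ.+ i))               ∎
  where open ≡-Reasoning

∑<-cong : ∀ n {f g} → (∀ i → i ℕ.< n → f i ≡ g i) → ∑< n f ≡ ∑< n g
∑<-cong zero    f≡g = refl
∑<-cong (suc n) f≡g = cong₂ _+_ (∑<-cong n (λ i i<n → f≡g i (ℕₚ.m<n⇒m<1+n i<n))) (f≡g n ℕₚ.≤-refl)

∑<-neg : ∀ n f → ∑< n (λ i → - f i) ≡ - ∑< n f
∑<-neg zero    f = refl
∑<-neg (suc n) f = trans (cong (_+ - f n) (∑<-neg n f)) (sym (neg-distrib-+ (∑< n f) (f n)))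

sumℤ-applyUpTo : ∀ (g : ℕ → ℤ) (h : ℕ → ℕ) n → sumℤ (map g (applyUpTo h n)) ≡ ∑< n (g ∘ h)
sumℤ-applyUpTo g h zero    = refl
sumℤ-applyUpTo g h (suc n) =
  trans (cong (_+_ (g (h 0))) (sumℤ-applyUpTo g (h ∘ suc) n)) (sym (∑<-cons n (g ∘ h)))

<-sucℤ⇒≤ : ∀ {i j} → i < sucℤ j → i ≤ j
<-sucℤ⇒≤ {i} {j} i<1+j = subst (i ≤_) (pred-suc j) (i<j⇒i≤pred[j] i<1+j)

/ℕ-unique : ∀ t q d .{{_ : ℕ.NonZero d}} → q * + d ≤ t → t < sucℤ q * + d → t /ℕ d ≡ q
/ℕ-unique t q d qd≤t t<[1+q]d = ≤-antisym
  (<-sucℤ⇒≤ (*-cancelʳ-<-nonNeg (+ d) (≤-<-trans ([n/ℕd]*d≤n t d) t<[1+q]d)))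
  (<-sucℤ⇒≤ (*-cancelʳ-<-nonNeg (+ d) (≤-<-trans qd≤t (n<s[n/ℕd]*d t d))))

/ℕ-+-* : ∀ t s d .{{_ : ℕ.NonZero d}} → (t + s * + d) /ℕ d ≡ t /ℕ d + s
/ℕ-+-* t s d = /ℕ-unique (t + s * + d) (Q + s) d
  (subst (_≤ t + s * + d) (sym (distribʳ Q s (+ d))) (+-monoˡ-≤ (s * + d) ([n/ℕd]*d≤n t d)))
  (subst (t + s * + d <_) (shift Q s (+ d)) (+-monoˡ-< (s * + d) (n<s[n/ℕd]*d t d)))
  where
  Q = t /ℕ d
  distribʳ : ∀ Q s D → (Q + s) * D ≡ Q * D + s * D
  distribʳ = solve-∀
  shift : ∀ Q s D → (1ℤ + Q) * D + s * D ≡ (1ℤ + (Q + s)) * D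
  shift = solve-∀

/ℕ-neg : ∀ t d .{{_ : ℕ.NonZero d}} → (∀ q → t ≢ q * + d) → (- t) /ℕ d ≡ - (t /ℕ d) - 1ℤ
/ℕ-neg t d d∤t = /ℕ-unique (- t) (- Q - 1ℤ) d
  (subst (_≤ - t) (lower Q (+ d)) (neg-mono-≤ (<⇒≤ (n<s[n/ℕd]*d t d))))
  (subst (- t <_) (upper Q (+ d)) (neg-mono-< (≤∧≢⇒< ([n/ℕd]*d≤n t d) (λ eq → d∤t Q (sym eq)))))
  where
  Q = t /ℕ d
  lower : ∀ Q D → - ((1ℤ + Q) * D) ≡ (- Q - 1ℤ) * D
  lower = solve-∀
  upper : ∀ Q D → - (Q * D) ≡ (1ℤ + (- Q - 1ℤ)) * D
  upper = solve-∀

m<[1+m/n]*n : ∀ m n .{{_ : ℕ.NonZero n}} → m ℕ.< suc (m ℕ./ n) ℕ.* n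
m<[1+m/n]*n m n = begin-strict
  m                            ≡⟨ ℕD.m≡m%n+[m/n]*n m n ⟩
  m ℕ.% n ℕ.+ m ℕ./ n ℕ.* n    <⟨ ℕₚ.+-monoˡ-< (m ℕ./ n ℕ.* n) (ℕD.m%n<n m n) ⟩
  n ℕ.+ m ℕ./ n ℕ.* n          ∎
  where open ℕₚ.≤-Reasoning

/-unique : ∀ m n x .{{_ : ℕ.NonZero n}} → x ℕ.* n ℕ.≤ m → m ℕ.< suc x ℕ.* n → m ℕ./ n ≡ x
/-unique m n x xn≤m m<[1+x]n = ℕₚ.≤-antisym (ℕₚ.≤-pred (ℕD.m<n*o⇒m/o<n m<[1+x]n))
  (subst (ℕ._≤ m ℕ./ n) (ℕD.m*n/n≡m x n) (ℕD./-monoˡ-≤ n xn≤m))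

near-even-multiple : ∀ x k → let N = suc k in (∀ q → x ≢ + N + q * (+ N + + N)) →
                     ∃[ q ] ∣ x - q * (+ N + + N) ∣ ℕ.< N
near-even-multiple x k x≢N[2N] with x %ℕ (suc k ℕ.+ suc k) ℕ.<? suc k
... | yes r<N = q , subst (λ y → ∣ y ∣ ℕ.< N) (sym x-2qN≡r) r<N
  where
  N = suc k
  q = x /ℕ (N ℕ.+ N)
  x-2qN≡r : x - q * (+ N + + N) ≡ + (x %ℕ (N ℕ.+ N))
  x-2qN≡r = trans (cong (λ y → y - q * (+ N + + N)) (a≡a%ℕn+[a/ℕn]*n x (N ℕ.+ N))) (cancel _ q (+ N))
    where
    cancel : ∀ r q n → r + q * (n + n) - q * (n + n) ≡ r
    cancel = solve-∀
... | no r≮N = sucℤ q , subst (λ y → ∣ y ∣ ℕ.< N) (sym x-2[q+1]N≡r-2N) 2N-r<N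
  where
  N = suc k
  D = N ℕ.+ N
  q = x /ℕ D
  r = x %ℕ D
  x≡r+2qN : x ≡ + r + q * (+ N + + N)
  x≡r+2qN = a≡a%ℕn+[a/ℕn]*n x D
  r≢N : r ≢ N
  r≢N r≡N = x≢N[2N] q (trans x≡r+2qN (cong (λ r → + r + q * (+ N + + N)) r≡N))
  N<r : N ℕ.< r
  N<r = ℕₚ.≤∧≢⇒< (ℕₚ.≮⇒≥ r≮N) (λ N≡r → r≢N (sym N≡r))
  r≤D : r ℕ.≤ D
  r≤D = ℕₚ.<⇒≤ (n%ℕd<d x D)
  x-2[q+1]N≡r-2N : x - sucℤ q * (+ N + + N) ≡ - + (D ℕ.∸ r)
  x-2[q+1]N≡r-2N = begin
    x - sucℤ q * (+ N + + N)                      ≡⟨ cong (λ y → y - sucℤ q * (+ N + + N)) x≡r+2qN ⟩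
    + r + q * (+ N + + N) - sucℤ q * (+ N + + N)  ≡⟨ cancel (+ r) q (+ N) ⟩
    + r - + D                                     ≡⟨ [+m]-[+n]≡m⊖n r D ⟩
    r ⊖ D                                         ≡⟨ ⊖-≤ r≤D ⟩
    - + (D ℕ.∸ r)                                 ∎
    where
    open ≡-Reasoning
    cancel : ∀ r q n → r + q * (n + n) - (1ℤ + q) * (n + n) ≡ r - (n + n)
    cancel = solve-∀
  2N-r<N : ∣ - + (D ℕ.∸ r) ∣ ℕ.< N
  2N-r<N = subst (ℕ._< N) (sym (∣-i∣≡∣i∣ (+ (D ℕ.∸ r))))
             (subst (D ℕ.∸ r ℕ.<_) (ℕₚ.m+n∸m≡n N N) (ℕₚ.∸-monoʳ-< N<r r≤D))

-- 𝔖 as a function of the first column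

𝔖′ : ℤ → ℤ → ℤ
𝔖′ x z = 𝔖 (mat x 0ℤ z 0ℤ)

𝔖≡𝔖′ : ∀ X → 𝔖 X ≡ 𝔖′ (a X) (c X)
𝔖≡𝔖′ (mat a b (+ zero) d) = refl
𝔖≡𝔖′ (mat a b (+ suc m) d) = refl
𝔖≡𝔖′ (mat a b -[1+ m ] d) = refl

term : ℤ → ℕ → ℕ → ℤ
term x m j = negOnePow ((+ suc j * x) /ℕ suc m + + suc j + 1ℤ)

𝔖′-pos : ∀ x m → 𝔖′ x (+ suc m) ≡ ∑< m (term x m)
𝔖′-pos x m = sumℤ-applyUpTo (term x m) (λ j → j) m

𝔖′-neg-suc : ∀ x m → 𝔖′ x -[1+ m ] ≡ 𝔖′ (- x) (+ suc m)
𝔖′-neg-suc x m = begin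
  𝔖′ x -[1+ m ]
    ≡⟨ sumℤ-applyUpTo summand (λ j → j) m ⟩
  ∑< m summand
    ≡⟨ ∑<-cong m (λ j _ → cong (λ y → negOnePow (y /ℕ suc m + + suc j + 1ℤ)) (neg-distribʳ-* (+ suc j) x)) ⟩
  ∑< m (term (- x) m)
    ≡⟨ 𝔖′-pos (- x) m ⟨
  𝔖′ (- x) (+ suc m)
    ∎
  where
  open ≡-Reasoning
  summand : ℕ → ℤ
  summand j = negOnePow ((- (+ suc j * x)) /ℕ suc m + + suc j + 1ℤ)

𝔖′-neg-neg : ∀ x y → 𝔖′ (- x) (- y) ≡ 𝔖′ x y
𝔖′-neg-neg x (+ zero)  = refl
𝔖′-neg-neg x (+ suc m) = trans (𝔖′-neg-suc (- x) m) (cong (λ x → 𝔖′ x (+ suc m)) (neg-involutive x))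
𝔖′-neg-neg x -[1+ m ]  = sym (𝔖′-neg-suc x m)

term-periodic : ∀ x n m j → term (x + n * (+ suc m + + suc m)) m j ≡ term x m j
term-periodic x n m j = begin
  negOnePow ((k * (x + n * (M + M))) /ℕ suc m + k + 1ℤ)
    ≡⟨ cong (λ y → negOnePow (y /ℕ suc m + k + 1ℤ)) (expand k x n M) ⟩
  negOnePow ((k * x + (k * n + k * n) * M) /ℕ suc m + k + 1ℤ)
    ≡⟨ cong (λ y → negOnePow (y + k + 1ℤ)) (/ℕ-+-* (k * x) (k * n + k * n) (suc m)) ⟩
  negOnePow (q + (k * n + k * n) + k + 1ℤ)
    ≡⟨ cong negOnePow (regroup q (k * n) k) ⟩
  negOnePow (q + k + 1ℤ + (k * n + k * n))
    ≡⟨ negOnePow-+-double (q + k + 1ℤ) (k * n) ⟩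
  negOnePow (q + k + 1ℤ)
    ∎
  where
  open ≡-Reasoning
  k = + suc j
  M = + suc m
  q = (k * x) /ℕ suc m
  expand : ∀ k x n M → k * (x + n * (M + M)) ≡ k * x + (k * n + k * n) * M
  expand = solve-∀
  regroup : ∀ q s k → q + (s + s) + k + 1ℤ ≡ q + k + 1ℤ + (s + s)
  regroup = solve-∀

𝔖′-periodic : ∀ x n y → 𝔖′ (x + n * (y + y)) y ≡ 𝔖′ x y
𝔖′-periodic x n (+ zero)  = refl
𝔖′-periodic x n (+ suc m) = begin
  𝔖′ (x + n * (+ suc m + + suc m)) (+ suc m)    ≡⟨ 𝔖′-pos (x + n * (+ suc m + + suc m)) m ⟩
  ∑< m (term (x + n * (+ suc m + + suc m)) m)   ≡⟨ ∑<-cong m (λ j _ → term-periodic x n m j) ⟩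
  ∑< m (term x m)                               ≡⟨ 𝔖′-pos x m ⟨
  𝔖′ x (+ suc m)                                ∎
  where open ≡-Reasoning
𝔖′-periodic x n -[1+ m ]  = begin
  𝔖′ (x + n * (y + y)) y               ≡⟨ 𝔖′-neg-suc (x + n * (y + y)) m ⟩
  𝔖′ (- (x + n * (y + y))) (- y)       ≡⟨ cong (λ x → 𝔖′ x (- y)) (negate x n y) ⟩
  𝔖′ (- x + n * (- y + - y)) (- y)     ≡⟨ 𝔖′-periodic (- x) n (+ suc m) ⟩
  𝔖′ (- x) (- y)                       ≡⟨ 𝔖′-neg-neg x y ⟩
  𝔖′ x y                               ∎
  where
  open ≡-Reasoning
  y = -[1+ m ]
  negate : ∀ x n y → - (x + n * (y + y)) ≡ - x + n * (- y + - y)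
  negate = solve-∀

term-neg : ∀ x m j → (∀ q → + suc j * x ≢ q * + suc m) → term (- x) m j ≡ - term x m j
term-neg x m j c∤kx = begin
  negOnePow ((k * - x) /ℕ suc m + k + 1ℤ)
    ≡⟨ cong (λ y → negOnePow (y /ℕ suc m + k + 1ℤ)) (neg-distribʳ-* k x) ⟨
  negOnePow ((- (k * x)) /ℕ suc m + k + 1ℤ)
    ≡⟨ cong (λ y → negOnePow (y + k + 1ℤ)) (/ℕ-neg (k * x) (suc m) c∤kx) ⟩
  negOnePow (- q - 1ℤ + k + 1ℤ)
    ≡⟨ cong negOnePow (regroup q k) ⟩
  negOnePow (q + k + 1ℤ + -1ℤ + - (q + q))
    ≡⟨ negOnePow-+ (q + k + 1ℤ + -1ℤ) (- (q + q)) ⟩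
  negOnePow (q + k + 1ℤ + -1ℤ) * negOnePow (- (q + q))
    ≡⟨ cong₂ _*_ (negOnePow-+ (q + k + 1ℤ) -1ℤ) (trans (negOnePow-neg (q + q)) (negOnePow-double q)) ⟩
  negOnePow (q + k + 1ℤ) * -1ℤ * 1ℤ
    ≡⟨ negate (negOnePow (q + k + 1ℤ)) ⟩
  - negOnePow (q + k + 1ℤ)
    ∎
  where
  open ≡-Reasoning
  k = + suc j
  q = (k * x) /ℕ suc m
  regroup : ∀ q k → - q - 1ℤ + k + 1ℤ ≡ q + k + 1ℤ + -1ℤ + - (q + q)
  regroup = solve-∀
  negate : ∀ s → s * -1ℤ * 1ℤ ≡ - s
  negate = solve-∀

coprime⇒∤ : ∀ x m → ℕC.Coprime (suc m) ∣ x ∣ → ∀ j → j ℕ.< m → ∀ q → + suc j * x ≢ q * + suc m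
coprime⇒∤ x m coprime j j<m q eq =
  ℕₚ.<⇒≱ (s≤s j<m) (∣⇒≤ (ℕC.coprime-divisor coprime (divides ∣ q ∣ ∣x∣[1+j]≡∣q∣[1+m])))
  where
  ∣x∣[1+j]≡∣q∣[1+m] : ∣ x ∣ ℕ.* suc j ≡ ∣ q ∣ ℕ.* suc m
  ∣x∣[1+j]≡∣q∣[1+m] = begin
    ∣ x ∣ ℕ.* suc j       ≡⟨ ℕₚ.*-comm ∣ x ∣ (suc j) ⟩
    suc j ℕ.* ∣ x ∣       ≡⟨ abs-* (+ suc j) x ⟨
    ∣ + suc j * x ∣       ≡⟨ cong ∣_∣ eq ⟩
    ∣ q * + suc m ∣       ≡⟨ abs-* q (+ suc m) ⟩
    ∣ q ∣ ℕ.* suc m       ∎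
    where open ≡-Reasoning

𝔖′-negˡ-pos : ∀ x m → ℕC.Coprime (suc m) ∣ x ∣ → 𝔖′ (- x) (+ suc m) ≡ - 𝔖′ x (+ suc m)
𝔖′-negˡ-pos x m coprime = begin
  𝔖′ (- x) (+ suc m)              ≡⟨ 𝔖′-pos (- x) m ⟩
  ∑< m (term (- x) m)             ≡⟨ ∑<-cong m (λ j j<m → term-neg x m j (coprime⇒∤ x m coprime j j<m)) ⟩
  ∑< m (λ j → - term x m j)       ≡⟨ ∑<-neg m (term x m) ⟩
  - ∑< m (term x m)               ≡⟨ cong -_ (𝔖′-pos x m) ⟨
  - 𝔖′ x (+ suc m)                ∎
  where open ≡-Reasoning

𝔖′-negˡ : ∀ x y → Coprime x y → 𝔖′ (- x) y ≡ - 𝔖′ x y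
𝔖′-negˡ x (+ zero)  coprime = refl
𝔖′-negˡ x (+ suc m) coprime = 𝔖′-negˡ-pos x m (ℕC.sym coprime)
𝔖′-negˡ x -[1+ m ]  coprime = begin
  𝔖′ (- x) -[1+ m ]          ≡⟨ 𝔖′-neg-suc (- x) m ⟩
  𝔖′ (- - x) (+ suc m)       ≡⟨ 𝔖′-negˡ-pos (- x) m coprime′ ⟩
  - 𝔖′ (- x) (+ suc m)       ≡⟨ cong -_ (𝔖′-neg-suc x m) ⟨
  - 𝔖′ x -[1+ m ]            ∎
  where
  open ≡-Reasoning
  coprime′ : ℕC.Coprime (suc m) ∣ - x ∣
  coprime′ = subst (ℕC.Coprime (suc m)) (sym (∣-i∣≡∣i∣ x)) (ℕC.sym coprime)

𝔖′-negʳ : ∀ x y → Coprime x y → 𝔖′ x (- y) ≡ - 𝔖′ x y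
𝔖′-negʳ x y coprime = begin
  𝔖′ x (- y)          ≡⟨ cong (λ x → 𝔖′ x (- y)) (neg-involutive x) ⟨
  𝔖′ (- - x) (- y)    ≡⟨ 𝔖′-neg-neg (- x) y ⟩
  𝔖′ (- x) y          ≡⟨ 𝔖′-negˡ x y coprime ⟩
  - 𝔖′ x y            ∎
  where open ≡-Reasoning

-- Reciprocity

alt : ℕ → ℤ
alt N = ∑< N σ

σ≡-1⇒alt≡1 : ∀ N → σ N ≡ -1ℤ → alt N ≡ 1ℤ
σ≡-1⇒alt≡1 zero          ()
σ≡-1⇒alt≡1 (suc zero)    _  = refl
σ≡-1⇒alt≡1 (suc (suc N)) σN≡-1 = begin
  alt N + σ N + σ (suc N)      ≡⟨ cong (_+_ (alt N + σ N)) (σ-suc N) ⟩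
  alt N + σ N + - σ N          ≡⟨ +-assoc (alt N) (σ N) (- σ N) ⟩
  alt N + (σ N + - σ N)        ≡⟨ cong (_+_ (alt N)) (+-inverseʳ (σ N)) ⟩
  alt N + 0ℤ                   ≡⟨ +-identityʳ (alt N) ⟩
  alt N                        ≡⟨ σ≡-1⇒alt≡1 N σN≡-1 ⟩
  1ℤ                           ∎
  where open ≡-Reasoning

merge : ∀ V Hₗ Hᵣ {A A′} → V + Hₗ ≡ A → Hᵣ + A ≡ Hₗ + A′ → V + Hᵣ ≡ A′
merge V Hₗ Hᵣ {A} {A′} p q = begin
  V + Hᵣ                                  ≡⟨ regroup V Hₗ Hᵣ A ⟩
  (V + Hₗ) + (Hᵣ + A) - Hₗ - A            ≡⟨ cong₂ (λ x y → x + y - Hₗ - A) p q ⟩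
  A + (Hₗ + A′) - Hₗ - A                  ≡⟨ cancel A Hₗ A′ ⟩
  A′                                      ∎
  where
  open ≡-Reasoning
  regroup : ∀ V Hₗ Hᵣ A → V + Hᵣ ≡ (V + Hₗ) + (Hᵣ + A) - Hₗ - A
  regroup = solve-∀
  cancel : ∀ A Hₗ A′ → A + (Hₗ + A′) - Hₗ - A ≡ A′
  cancel = solve-∀

-- v and h are the summands of 𝔖′ p q and 𝔖′ q p. For coprime p, q the points k/q (0 < k < q)
-- and i/p (0 < i < p) are distinct, and up to parity the exponent of v (k - 1) is the position
-- of k/q in the increasing list of all these points (likewise for h), so ∑ v + ∑ h is the
-- alternating sum of length p + q - 2. The invariant records this for the points up to x/q.
module Reciprocity (n m : ℕ) (coprime : ℕC.Coprime (suc n) (suc m)) where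

  p q : ℕ
  p = suc n
  q = suc m

  E : ℕ → ℕ
  E x = x ℕ.* p ℕ./ q

  v h : ℕ → ℤ
  v j = σ (suc j ℕ.* p ℕ./ q ℕ.+ suc j ℕ.+ 1)
  h i = σ (suc i ℕ.* q ℕ./ p ℕ.+ suc i ℕ.+ 1)

  E<p : ∀ x → x ℕ.< q → E x ℕ.< p
  E<p x x<q = ℕD.m<n*o⇒m/o<n (subst (x ℕ.* p ℕ.<_) (ℕₚ.*-comm q p) (ℕₚ.*-monoˡ-< p x<q))

  point-below : ∀ x i → 0 ℕ.< i → i ℕ.< p → i ℕ.≤ E x → i ℕ.* q ℕ.< x ℕ.* p
  point-below x i 0<i i<p i≤Ex = ℕₚ.≤∧≢⇒< (ℕₚ.≤-trans (ℕₚ.*-monoˡ-≤ q i≤Ex) (ℕD.m/n*n≤m (x ℕ.* p) q)) iq≢xp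
    where
    iq≢xp : i ℕ.* q ≢ x ℕ.* p
    iq≢xp eq = ℕₚ.<⇒≱ i<p (∣⇒≤ {{ℕ.>-nonZero 0<i}}
      (ℕC.coprime-divisor coprime (divides x (trans (ℕₚ.*-comm q i) eq))))

  h-between : ∀ x i → E x ℕ.< suc i → suc i ℕ.* q ℕ.< suc x ℕ.* p → h i ≡ σ (x ℕ.+ i)
  h-between x i Ex<1+i <[1+x]p = cong σ (begin
    suc i ℕ.* q ℕ./ p ℕ.+ suc i ℕ.+ 1   ≡⟨ cong (λ y → y ℕ.+ suc i ℕ.+ 1) (/-unique _ p x xp≤ <[1+x]p) ⟩
    x ℕ.+ suc i ℕ.+ 1                    ≡⟨ ℕₚ.+-comm (x ℕ.+ suc i) 1 ⟩
    suc (x ℕ.+ suc i)                    ≡⟨ cong suc (ℕₚ.+-suc x i) ⟩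
    suc (suc (x ℕ.+ i))                  ∎)
    where
    open ≡-Reasoning
    xp≤ : x ℕ.* p ℕ.≤ suc i ℕ.* q
    xp≤ = ℕₚ.<⇒≤ (ℕₚ.<-≤-trans (m<[1+m/n]*n (x ℕ.* p) q) (ℕₚ.*-monoˡ-≤ q Ex<1+i))

  block : ∀ x L d → (∀ i → i ℕ.< d → h (L ℕ.+ i) ≡ σ (x ℕ.+ L ℕ.+ i)) →
          ∑< (L ℕ.+ d) h + alt (x ℕ.+ L) ≡ ∑< L h + alt (x ℕ.+ L ℕ.+ d)
  block x L d h≡σ = begin
    ∑< (L ℕ.+ d) h + alt (x ℕ.+ L)               ≡⟨ cong (_+ alt (x ℕ.+ L)) (∑<-+ L d h) ⟩
    ∑< L h + Δ + alt (x ℕ.+ L)                    ≡⟨ swap (∑< L h) Δ (alt (x ℕ.+ L)) ⟩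
    ∑< L h + (alt (x ℕ.+ L) + Δ)                  ≡⟨ cong (λ y → ∑< L h + (alt (x ℕ.+ L) + y)) Δ≡ ⟩
    ∑< L h + (alt (x ℕ.+ L) + ∑< d (λ i → σ (x ℕ.+ L ℕ.+ i)))
                                                 ≡⟨ cong (_+_ (∑< L h)) (∑<-+ (x ℕ.+ L) d σ) ⟨
    ∑< L h + alt (x ℕ.+ L ℕ.+ d)                  ∎
    where
    open ≡-Reasoning
    Δ = ∑< d (λ i → h (L ℕ.+ i))
    Δ≡ : Δ ≡ ∑< d (λ i → σ (x ℕ.+ L ℕ.+ i))
    Δ≡ = ∑<-cong d h≡σ
    swap : ∀ H D A → H + D + A ≡ H + (A + D)
    swap = solve-∀

  invariant : ∀ x → x ℕ.< q → ∑< x v + ∑< (E x) h ≡ alt (x ℕ.+ E x)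
  invariant zero    _     = refl
  invariant (suc x) 1+x<q = begin
    ∑< x v + v x + ∑< R h      ≡⟨ swap (∑< x v) (v x) (∑< R h) ⟩
    ∑< x v + ∑< R h + v x      ≡⟨ cong₂ _+_ (merge (∑< x v) (∑< L h) (∑< R h) invariant′ block′) vx≡ ⟩
    alt (x ℕ.+ R) + σ (x ℕ.+ R) ∎
    where
    open ≡-Reasoning
    swap : ∀ V u H → V + u + H ≡ V + H + u
    swap = solve-∀
    L = E x
    R = E (suc x)
    invariant′ : ∑< x v + ∑< L h ≡ alt (x ℕ.+ L)
    invariant′ = invariant x (ℕₚ.<-trans (ℕₚ.n<1+n x) 1+x<q)
    L≤R : L ℕ.≤ R
    L≤R = ℕD./-monoˡ-≤ q (ℕₚ.*-monoˡ-≤ p (ℕₚ.n≤1+n x))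
    δ = R ℕ.∸ L
    L+δ≡R : L ℕ.+ δ ≡ R
    L+δ≡R = ℕₚ.m+[n∸m]≡n L≤R
    h≡σ : ∀ i → i ℕ.< δ → h (L ℕ.+ i) ≡ σ (x ℕ.+ L ℕ.+ i)
    h≡σ i i<δ = trans (h-between x (L ℕ.+ i) (s≤s (ℕₚ.m≤m+n L i))
                        (point-below (suc x) (suc (L ℕ.+ i)) (s≤s z≤n) (ℕₚ.≤-<-trans 1+L+i≤R (E<p (suc x) 1+x<q)) 1+L+i≤R))
                      (cong σ (sym (ℕₚ.+-assoc x L i)))
      where
      1+L+i≤R : suc (L ℕ.+ i) ℕ.≤ R
      1+L+i≤R = subst (suc (L ℕ.+ i) ℕ.≤_) L+δ≡R (subst (ℕ._≤ L ℕ.+ δ) (ℕₚ.+-suc L i) (ℕₚ.+-monoʳ-≤ L i<δ))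
    block′ : ∑< R h + alt (x ℕ.+ L) ≡ ∑< L h + alt (x ℕ.+ R)
    block′ = subst₂ (λ r s → ∑< r h + alt (x ℕ.+ L) ≡ ∑< L h + alt s) L+δ≡R
               (trans (ℕₚ.+-assoc x L δ) (cong (x ℕ.+_) L+δ≡R)) (block x L δ h≡σ)
    vx≡ : v x ≡ σ (x ℕ.+ R)
    vx≡ = cong σ (trans (ℕₚ.+-comm (R ℕ.+ suc x) 1) (cong suc (trans (ℕₚ.+-suc R x) (cong suc (ℕₚ.+-comm R x)))))

  reciprocity : σ (m ℕ.+ n) ≡ -1ℤ → ∑< m v + ∑< n h ≡ 1ℤ
  reciprocity odd =
    trans (merge (∑< m v) (∑< L h) (∑< n h) (invariant m (ℕₚ.n<1+n m)) block′) (σ≡-1⇒alt≡1 (m ℕ.+ n) odd)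
    where
    L = E m
    L≤n : L ℕ.≤ n
    L≤n = ℕₚ.≤-pred (E<p m (ℕₚ.n<1+n m))
    δ = n ℕ.∸ L
    L+δ≡n : L ℕ.+ δ ≡ n
    L+δ≡n = ℕₚ.m+[n∸m]≡n L≤n
    h≡σ : ∀ i → i ℕ.< δ → h (L ℕ.+ i) ≡ σ (m ℕ.+ L ℕ.+ i)
    h≡σ i i<δ = trans (h-between m (L ℕ.+ i) (s≤s (ℕₚ.m≤m+n L i))
                        (subst (suc (L ℕ.+ i) ℕ.* q ℕ.<_) (ℕₚ.*-comm p q) (ℕₚ.*-monoˡ-< q (s≤s L+i<n))))
                      (cong σ (sym (ℕₚ.+-assoc m L i)))
      where
      L+i<n : L ℕ.+ i ℕ.< n
      L+i<n = subst (L ℕ.+ i ℕ.<_) L+δ≡n (ℕₚ.+-monoʳ-< L i<δ)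
    block′ : ∑< n h + alt (m ℕ.+ L) ≡ ∑< L h + alt (m ℕ.+ n)
    block′ = subst₂ (λ r s → ∑< r h + alt (m ℕ.+ L) ≡ ∑< L h + alt s) L+δ≡n
               (trans (ℕₚ.+-assoc m L δ) (cong (m ℕ.+_) L+δ≡n)) (block m L δ h≡σ)

reciprocity-pos : ∀ n m → ℕC.Coprime (suc n) (suc m) → Odd (+ suc n + + suc m) →
                  𝔖′ (+ suc n) (+ suc m) + 𝔖′ (+ suc m) (+ suc n) ≡ 1ℤ
reciprocity-pos n m coprime odd = begin
  𝔖′ (+ suc n) (+ suc m) + 𝔖′ (+ suc m) (+ suc n)   ≡⟨ cong₂ _+_ (𝔖′-pos (+ suc n) m) (𝔖′-pos (+ suc m) n) ⟩
  ∑< m v + ∑< n h                                   ≡⟨ reciprocity (trans σ[m+n]≡σ[1+n+1+m] odd) ⟩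
  1ℤ                                                ∎
  where
  open ≡-Reasoning
  open Reciprocity n m coprime
  σ[m+n]≡σ[1+n+1+m] : σ (m ℕ.+ n) ≡ σ (suc n ℕ.+ suc m)
  σ[m+n]≡σ[1+n+1+m] = trans (cong σ (ℕₚ.+-comm m n)) (cong (λ k → σ (suc k)) (sym (ℕₚ.+-suc n m)))

coprime-0 : ∀ {k} → ℕC.Coprime 0 k → k ≡ 1
coprime-0 {k} coprime = coprime (k ∣0 , ∣-refl)

Reciprocal : ℤ → ℤ → Set
Reciprocal x z = 𝔖′ x z + 𝔖′ z x ≡ sgn (x * z)

reciprocal-sym : ∀ x z → Reciprocal x z → Reciprocal z x
reciprocal-sym x z r = trans (+-comm (𝔖′ z x) (𝔖′ x z)) (trans r (cong sgn (*-comm x z)))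

reciprocal-negˡ : ∀ x z → Coprime x z → Reciprocal x z → Reciprocal (- x) z
reciprocal-negˡ x z coprime r = begin
  𝔖′ (- x) z + 𝔖′ z (- x)        ≡⟨ cong₂ _+_ (𝔖′-negˡ x z coprime) (𝔖′-negʳ z x (ℕC.sym coprime)) ⟩
  - 𝔖′ x z + - 𝔖′ z x            ≡⟨ neg-distrib-+ (𝔖′ x z) (𝔖′ z x) ⟨
  - (𝔖′ x z + 𝔖′ z x)            ≡⟨ cong -_ r ⟩
  - sgn (x * z)                  ≡⟨ sgn-neg (x * z) ⟨
  sgn (- (x * z))                ≡⟨ cong sgn (neg-distribˡ-* x z) ⟩
  sgn (- x * z)                  ∎
  where open ≡-Reasoning

reciprocal-negʳ : ∀ x z → Coprime x z → Reciprocal x z → Reciprocal x (- z)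
reciprocal-negʳ x z coprime r =
  reciprocal-sym (- z) x (reciprocal-negˡ z x (ℕC.sym coprime) (reciprocal-sym x z r))

reciprocal-ℕ : ∀ n m → ℕC.Coprime n m → Odd (+ n + + m) → Reciprocal (+ n) (+ m)
reciprocal-ℕ (suc n) (suc m) coprime odd = reciprocity-pos n m coprime odd
reciprocal-ℕ zero zero coprime odd with () ← coprime-0 coprime
reciprocal-ℕ zero 1 coprime odd = refl
reciprocal-ℕ zero (suc (suc k)) coprime odd with () ← coprime-0 coprime
reciprocal-ℕ 1 zero coprime odd = refl
reciprocal-ℕ (suc (suc k)) zero coprime odd with () ← coprime-0 (ℕC.sym coprime)

𝔖′-reciprocity : ∀ x z → Coprime x z → Odd (x + z) → Reciprocal x z
𝔖′-reciprocity (+ n) (+ m) coprime odd = reciprocal-ℕ n m coprime odd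
𝔖′-reciprocity (+ n) -[1+ m ] coprime odd =
  reciprocal-negʳ (+ n) (+ suc m) coprime
    (reciprocal-ℕ n (suc m) coprime (trans (negOnePow-+-∣∣ (+ n) (+ suc m) (+ n) -[1+ m ] refl refl) odd))
𝔖′-reciprocity -[1+ n ] (+ m) coprime odd =
  reciprocal-negˡ (+ suc n) (+ m) coprime
    (reciprocal-ℕ (suc n) m coprime (trans (negOnePow-+-∣∣ (+ suc n) (+ m) -[1+ n ] (+ m) refl refl) odd))
𝔖′-reciprocity -[1+ n ] -[1+ m ] coprime odd =
  reciprocal-negˡ (+ suc n) -[1+ m ] coprime (reciprocal-negʳ (+ suc n) (+ suc m) coprime
    (reciprocal-ℕ (suc n) (suc m) coprime (trans (negOnePow-+-∣∣ (+ suc n) (+ suc m) -[1+ n ] -[1+ m ] refl refl) odd)))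

-- The theta group

record OddColumns (X : M2) : Set where
  field
    det≡1    : a X * d X - b X * c X ≡ 1ℤ
    odd-col₁ : Odd (a X + c X)
    odd-col₂ : Odd (b X + d X)

-- left multiplication by (1 2t ; 0 1) and by (0 1 ; -1 0)
shift : ℤ → M2 → M2
shift t X = mat (a X + t * (c X + c X)) (b X + t * (d X + d X)) (c X) (d X)

rotate : M2 → M2
rotate X = mat (c X) (d X) (- a X) (- b X)

shift-⊗ : ∀ t A B → shift t A ⊗ B ≡ shift t (A ⊗ B)
shift-⊗ t A B = cong₂ (λ x y → mat x y (c (A ⊗ B)) (d (A ⊗ B)))
  (expand (a A) (b A) (c A) (d A) (a B) (c B) t) (expand (a A) (b A) (c A) (d A) (b B) (d B) t)
  where
  expand : ∀ a b c d x y t → (a + t * (c + c)) * x + (b + t * (d + d)) * y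
                             ≡ a * x + b * y + t * ((c * x + d * y) + (c * x + d * y))
  expand = solve-∀

rotate-⊗ : ∀ A B → rotate A ⊗ B ≡ rotate (A ⊗ B)
rotate-⊗ A B = cong₂ (λ x y → mat (c (A ⊗ B)) (d (A ⊗ B)) x y)
  (negate (a A) (b A) (a B) (c B)) (negate (a A) (b A) (b B) (d B))
  where
  negate : ∀ a b x y → - a * x + - b * y ≡ - (a * x + b * y)
  negate = solve-∀

oddColumns-shift : ∀ t X → OddColumns X → OddColumns (shift t X)
oddColumns-shift t X θ = record
  { det≡1    = trans (unchanged (a X) (b X) (c X) (d X) t) det≡1
  ; odd-col₁ = trans (cong negOnePow (regroup (a X) (c X) t)) (trans (negOnePow-+-double (a X + c X) (t * c X)) odd-col₁)
  ; odd-col₂ = trans (cong negOnePow (regroup (b X) (d X) t)) (trans (negOnePow-+-double (b X + d X) (t * d X)) odd-col₂)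
  }
  where
  open OddColumns θ
  unchanged : ∀ a b c d t → (a + t * (c + c)) * d - (b + t * (d + d)) * c ≡ a * d - b * c
  unchanged = solve-∀
  regroup : ∀ a c t → a + t * (c + c) + c ≡ (a + c) + (t * c + t * c)
  regroup = solve-∀

oddColumns-rotate : ∀ X → OddColumns X → OddColumns (rotate X)
oddColumns-rotate X θ = record
  { det≡1    = trans (unchanged (a X) (b X) (c X) (d X)) det≡1
  ; odd-col₁ = trans (swap (c X) (a X)) odd-col₁
  ; odd-col₂ = trans (swap (d X) (b X)) odd-col₂
  }
  where
  open OddColumns θ
  unchanged : ∀ a b c d → c * - b - d * - a ≡ a * d - b * c
  unchanged = solve-∀
  swap : ∀ x y → negOnePow (x + - y) ≡ negOnePow (y + x)
  swap x y = trans (negOnePow-+-∣∣ x (- y) x y refl (∣-i∣≡∣i∣ y)) (cong negOnePow (+-comm x y))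

det-⊗ : ∀ A B → let X = A ⊗ B in a X * d X - b X * c X ≡ (a A * d A - b A * c A) * (a B * d B - b B * c B)
det-⊗ A B = multiplicative (a A) (b A) (c A) (d A) (a B) (b B) (c B) (d B)
  where
  multiplicative : ∀ a₁ b₁ c₁ d₁ a₂ b₂ c₂ d₂ →
    (a₁ * a₂ + b₁ * c₂) * (c₁ * b₂ + d₁ * d₂) - (a₁ * b₂ + b₁ * d₂) * (c₁ * a₂ + d₁ * c₂)
    ≡ (a₁ * d₁ - b₁ * c₁) * (a₂ * d₂ - b₂ * c₂)
  multiplicative = solve-∀

oddColumns-⊗ : ∀ A B → OddColumns A → OddColumns B → OddColumns (A ⊗ B)
oddColumns-⊗ A B θA θB = record
  { det≡1    = trans (det-⊗ A B) (cong₂ _*_ (OddColumns.det≡1 θA) (OddColumns.det≡1 θB))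
  ; odd-col₁ = subst Odd (regroup (a A) (b A) (c A) (d A) (a B) (c B))
                 (odd-combination (a A + c A) (b A + d A) (a B) (c B) oddA₁ oddA₂ (OddColumns.odd-col₁ θB))
  ; odd-col₂ = subst Odd (regroup (a A) (b A) (c A) (d A) (b B) (d B))
                 (odd-combination (a A + c A) (b A + d A) (b B) (d B) oddA₁ oddA₂ (OddColumns.odd-col₂ θB))
  }
  where
  open OddColumns θA using () renaming (odd-col₁ to oddA₁; odd-col₂ to oddA₂)
  regroup : ∀ a b c d x y → (a + c) * x + (b + d) * y ≡ (a * x + b * y) + (c * x + d * y)
  regroup = solve-∀

-- det X ≡ a² - c² ≡ a + c (mod 2), since a ≡ d and b ≡ c
inΓθ⇒oddColumns : ∀ X → InΓθ X → OddColumns X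
inΓθ⇒oddColumns (mat a b c d) (det≡1 , 2∣a-d , 2∣b-c)
  with ℤD.∣ᵤ⇒∣ 2∣a-d | ℤD.∣ᵤ⇒∣ 2∣b-c
... | ℤD.divides u a-d≡2u | ℤD.divides w b-c≡2w = record
  { det≡1    = det≡1
  ; odd-col₁ = odd-a+c
  ; odd-col₂ = subst Odd (sym b+d≡) (trans (negOnePow-+-double (a + c) (w - u)) odd-a+c)
  }
  where
  open ≡-Reasoning
  s = - (a * u) - w * c
  d≡ : d ≡ a - u * + 2
  d≡ = trans (expand a d) (cong (λ y → a - y) a-d≡2u)
    where
    expand : ∀ a d → d ≡ a - (a - d)
    expand = solve-∀
  b≡ : b ≡ c + w * + 2
  b≡ = trans (expand b c) (cong (_+_ c) b-c≡2w)
    where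
    expand : ∀ b c → b ≡ c + (b - c)
    expand = solve-∀
  det≡ : a * d - b * c ≡ a * a + - (c * c) + (s + s)
  det≡ = trans (cong₂ (λ d b → a * d - b * c) d≡ b≡) (expand a c u w)
    where
    expand : ∀ a c u w → let s = - (a * u) - w * c in
             a * (a - u * + 2) - (c + w * + 2) * c ≡ a * a + - (c * c) + (s + s)
    expand = solve-∀
  b+d≡ : b + d ≡ a + c + ((w - u) + (w - u))
  b+d≡ = trans (cong₂ _+_ b≡ d≡) (expand a c u w)
    where
    expand : ∀ a c u w → c + w * + 2 + (a - u * + 2) ≡ a + c + ((w - u) + (w - u))
    expand = solve-∀
  c²≡ : negOnePow (- (c * c)) ≡ negOnePow c
  c²≡ = trans (negOnePow-neg (c * c)) (negOnePow-square c)
  odd-a+c : Odd (a + c)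
  odd-a+c = begin
    negOnePow (a + c)                              ≡⟨ negOnePow-+ a c ⟩
    negOnePow a * negOnePow c                      ≡⟨ cong₂ _*_ (negOnePow-square a) c²≡ ⟨
    negOnePow (a * a) * negOnePow (- (c * c))      ≡⟨ negOnePow-+ (a * a) (- (c * c)) ⟨
    negOnePow (a * a + - (c * c))                  ≡⟨ negOnePow-+-double (a * a + - (c * c)) s ⟨
    negOnePow (a * a + - (c * c) + (s + s))        ≡⟨ cong negOnePow det≡ ⟨
    negOnePow (a * d - b * c)                      ≡⟨ cong negOnePow det≡1 ⟩
    -1ℤ                                            ∎

bézout⇒coprime : ∀ x y z w → x * w - y * z ≡ 1ℤ → Coprime x z
bézout⇒coprime x y z w det≡1 {k} (k∣x , k∣z) with ℤD.∣ᵤ⇒∣ {+ k} {x} k∣x | ℤD.∣ᵤ⇒∣ {+ k} {z} k∣z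
... | ℤD.divides q₁ x≡q₁k | ℤD.divides q₂ z≡q₂k =
  ∣1⇒≡1 (divides ∣ Q ∣ (trans (cong ∣_∣ 1≡Qk) (abs-* Q (+ k))))
  where
  Q = q₁ * w - y * q₂
  1≡Qk : 1ℤ ≡ Q * + k
  1≡Qk = trans (sym det≡1) (trans (cong₂ (λ x z → x * w - y * z) x≡q₁k z≡q₂k) (factor q₁ q₂ w y (+ k)))
    where
    factor : ∀ q₁ q₂ w y k → q₁ * k * w - y * (q₂ * k) ≡ (q₁ * w - y * q₂) * k
    factor = solve-∀

det≡1⇒nonZero : ∀ x y z w → x * w - y * z ≡ 1ℤ → NonZeroVec x z
det≡1⇒nonZero .(+ 0) y .(+ 0) w det≡1 (refl , refl)
  with () ← trans (sym det≡1) (cong (λ u → 0ℤ - u) (*-zeroʳ y))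

𝔖-shift : ∀ t X → 𝔖 (shift t X) ≡ 𝔖 X
𝔖-shift t X = trans (𝔖≡𝔖′ (shift t X)) (trans (𝔖′-periodic (a X) t (c X)) (sym (𝔖≡𝔖′ X)))

𝔖-rotate : ∀ X → OddColumns X → 𝔖 (rotate X) ≡ 𝔖 X - sgn (a X * c X)
𝔖-rotate X θ = begin
  𝔖 (rotate X)                             ≡⟨ 𝔖≡𝔖′ (rotate X) ⟩
  𝔖′ (c X) (- a X)                         ≡⟨ 𝔖′-negʳ (c X) (a X) (ℕC.sym coprime) ⟩
  - 𝔖′ (c X) (a X)                         ≡⟨ isolate (𝔖′ (a X) (c X)) (𝔖′ (c X) (a X)) ⟩
  𝔖′ (a X) (c X) - (𝔖′ (a X) (c X) + 𝔖′ (c X) (a X))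
                                           ≡⟨ cong₂ _-_ (sym (𝔖≡𝔖′ X)) (𝔖′-reciprocity (a X) (c X) coprime odd-col₁) ⟩
  𝔖 X - sgn (a X * c X)                    ∎
  where
  open ≡-Reasoning
  open OddColumns θ
  coprime = bézout⇒coprime (a X) (b X) (c X) (d X) det≡1
  isolate : ∀ s s′ → - s′ ≡ s - (s + s′)
  isolate = solve-∀

c-from-product : ∀ A B → a A * d A - b A * c A ≡ 1ℤ → c B ≡ a A * c (A ⊗ B) - c A * a (A ⊗ B)
c-from-product A B det≡1 = trans (sym (trans (cong (_* c B) det≡1) (*-identityˡ (c B))))
                                 (expand (a A) (b A) (c A) (d A) (a B) (c B))
  where
  expand : ∀ a b c d x y → (a * d - b * c) * y ≡ a * (c * x + d * y) - c * (a * x + b * y)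
  expand = solve-∀

Cocycle : M2 → M2 → Set
Cocycle A B = 𝔖 (A ⊗ B) - 𝔖 A - 𝔖 B ≡ - sgn (c A * c B * c (A ⊗ B))

cocycle-shift : ∀ t A B → Cocycle (shift t A) B → Cocycle A B
cocycle-shift t A B cocycle =
  subst₂ (λ x y → x - y - 𝔖 B ≡ - sgn (c A * c B * c (A ⊗ B))) (𝔖-shift t (A ⊗ B)) (𝔖-shift t A)
    (subst (λ Y → 𝔖 Y - 𝔖 (shift t A) - 𝔖 B ≡ - sgn (c A * c B * c Y)) (shift-⊗ t A B) cocycle)

cocycle-rotate : ∀ A B → OddColumns A → OddColumns B → Cocycle (rotate A) B → Cocycle A B
cocycle-rotate A B θA θB cocycle = begin
  𝔖 X - 𝔖 A - 𝔖 B
    ≡⟨ regroup (𝔖 X) (𝔖 A) (𝔖 B) s₂ s₁ ⟩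
  (𝔖 X - s₂) - (𝔖 A - s₁) - 𝔖 B + (s₂ - s₁)
    ≡⟨ cong₂ (λ x y → x - y - 𝔖 B + (s₂ - s₁)) (𝔖-rotate X θX) (𝔖-rotate A θA) ⟨
  𝔖 (rotate X) - 𝔖 (rotate A) - 𝔖 B + (s₂ - s₁)
    ≡⟨ cong (_+ (s₂ - s₁)) rotated ⟩
  - sgn (a₁ * a₂ * D) + (s₂ - s₁)
    ≡⟨ cong (_+_ (- sgn (a₁ * a₂ * D))) (sgn-cocycle a₁ c₁ a₂ c₂ (nonZero A θA) (nonZero X θX)) ⟨
  - sgn (a₁ * a₂ * D) + (sgn (a₁ * a₂ * D) - sgn (c₁ * c₂ * D))
    ≡⟨ cancel (sgn (a₁ * a₂ * D)) (sgn (c₁ * c₂ * D)) ⟩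
  - sgn (c₁ * c₂ * D)
    ≡⟨ cong (λ y → - sgn y) (trans (cong (c₁ * c₂ *_) (sym cB≡D)) (*-comm-last c₁ c₂ (c B))) ⟩
  - sgn (c₁ * c B * c₂)
    ∎
  where
  open ≡-Reasoning
  X = A ⊗ B
  a₁ = a A
  c₁ = c A
  a₂ = a X
  c₂ = c X
  s₁ = sgn (a₁ * c₁)
  s₂ = sgn (a₂ * c₂)
  D = a₁ * c₂ - c₁ * a₂
  θX = oddColumns-⊗ A B θA θB
  nonZero : ∀ Y → OddColumns Y → NonZeroVec (a Y) (c Y)
  nonZero Y θ = det≡1⇒nonZero (a Y) (b Y) (c Y) (d Y) (OddColumns.det≡1 θ)
  cB≡D : c B ≡ D
  cB≡D = c-from-product A B (OddColumns.det≡1 θA)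
  rotated : 𝔖 (rotate X) - 𝔖 (rotate A) - 𝔖 B ≡ - sgn (a₁ * a₂ * D)
  rotated = trans (subst (λ Y → 𝔖 Y - 𝔖 (rotate A) - 𝔖 B ≡ - sgn (- a₁ * c B * c Y)) (rotate-⊗ A B) cocycle)
                  (cong (λ y → - sgn y) (trans (negate a₁ (c B) a₂) (cong (a₁ * a₂ *_) cB≡D)))
    where
    negate : ∀ x y z → - x * y * - z ≡ x * z * y
    negate = solve-∀
  regroup : ∀ x y z s t → x - y - z ≡ (x - s) - (y - t) - z + (s - t)
  regroup = solve-∀
  cancel : ∀ x y → - x + (x - y) ≡ - y
  cancel = solve-∀
  *-comm-last : ∀ x y z → x * y * z ≡ x * z * y
  *-comm-last = solve-∀

∣x∣≡1⇒x≡±1 : ∀ x → ∣ x ∣ ≡ 1 → x ≡ 1ℤ ⊎ x ≡ -1ℤ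
∣x∣≡1⇒x≡±1 (+ 1)       _ = inj₁ refl
∣x∣≡1⇒x≡±1 -[1+ zero ] _ = inj₂ refl

unit-product : ∀ x y → x * y ≡ 1ℤ → (x ≡ 1ℤ × y ≡ 1ℤ) ⊎ (x ≡ -1ℤ × y ≡ -1ℤ)
unit-product x y xy≡1 with ∣x∣≡1⇒x≡±1 x (ℕₚ.m*n≡1⇒m≡1 ∣ x ∣ ∣ y ∣ ∣xy∣≡1)
                         | ∣x∣≡1⇒x≡±1 y (ℕₚ.m*n≡1⇒n≡1 ∣ x ∣ ∣ y ∣ ∣xy∣≡1)
  where
  ∣xy∣≡1 : ∣ x ∣ ℕ.* ∣ y ∣ ≡ 1
  ∣xy∣≡1 = trans (sym (abs-* x y)) (cong ∣_∣ xy≡1)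
... | inj₁ refl | inj₁ refl = inj₁ (refl , refl)
... | inj₂ refl | inj₂ refl = inj₂ (refl , refl)
... | inj₁ refl | inj₂ refl with () ← xy≡1
... | inj₂ refl | inj₁ refl with () ← xy≡1

𝔖-translation-⊗ : ∀ s B → 𝔖 (mat 1ℤ (s + s) 0ℤ 1ℤ ⊗ B) ≡ 𝔖 B
𝔖-translation-⊗ s B = begin
  𝔖 (mat 1ℤ (s + s) 0ℤ 1ℤ ⊗ B)                          ≡⟨ 𝔖≡𝔖′ (mat 1ℤ (s + s) 0ℤ 1ℤ ⊗ B) ⟩
  𝔖′ (1ℤ * a B + (s + s) * c B) (0ℤ * a B + 1ℤ * c B)   ≡⟨ cong₂ 𝔖′ (col₁ (a B) (c B) s) (col₂ (a B) (c B)) ⟩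
  𝔖′ (a B + s * (c B + c B)) (c B)                       ≡⟨ 𝔖′-periodic (a B) s (c B) ⟩
  𝔖′ (a B) (c B)                                         ≡⟨ 𝔖≡𝔖′ B ⟨
  𝔖 B                                                    ∎
  where
  open ≡-Reasoning
  col₁ : ∀ x y s → 1ℤ * x + (s + s) * y ≡ x + s * (y + y)
  col₁ = solve-∀
  col₂ : ∀ x y → 0ℤ * x + 1ℤ * y ≡ y
  col₂ = solve-∀

𝔖-neg-translation-⊗ : ∀ s B → 𝔖 (mat -1ℤ (s + s) 0ℤ -1ℤ ⊗ B) ≡ 𝔖 B
𝔖-neg-translation-⊗ s B = begin
  𝔖 (mat -1ℤ (s + s) 0ℤ -1ℤ ⊗ B)                          ≡⟨ 𝔖≡𝔖′ (mat -1ℤ (s + s) 0ℤ -1ℤ ⊗ B) ⟩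
  𝔖′ (-1ℤ * a B + (s + s) * c B) (0ℤ * a B + -1ℤ * c B)   ≡⟨ cong₂ 𝔖′ (col₁ (a B) (c B) s) (col₂ (a B) (c B)) ⟩
  𝔖′ (- (a B + (- s) * (c B + c B))) (- c B)              ≡⟨ 𝔖′-neg-neg (a B + (- s) * (c B + c B)) (c B) ⟩
  𝔖′ (a B + (- s) * (c B + c B)) (c B)                    ≡⟨ 𝔖′-periodic (a B) (- s) (c B) ⟩
  𝔖′ (a B) (c B)                                           ≡⟨ 𝔖≡𝔖′ B ⟨
  𝔖 B                                                      ∎
  where
  open ≡-Reasoning
  col₁ : ∀ x y s → -1ℤ * x + (s + s) * y ≡ - (x + (- s) * (y + y))
  col₁ = solve-∀
  col₂ : ∀ x y → 0ℤ * x + -1ℤ * y ≡ - y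
  col₂ = solve-∀

cocycle-upper : ∀ a₁ b₁ d₁ B → OddColumns (mat a₁ b₁ 0ℤ d₁) → Cocycle (mat a₁ b₁ 0ℤ d₁) B
cocycle-upper a₁ b₁ d₁ B θ = trans (cong (λ x → x - 0ℤ - 𝔖 B) 𝔖[AB]≡𝔖B) (cancel (𝔖 B))
  where
  open OddColumns θ
  cancel : ∀ x → x - 0ℤ - x ≡ 0ℤ
  cancel = solve-∀
  a₁d₁≡1 : a₁ * d₁ ≡ 1ℤ
  a₁d₁≡1 = trans (sym (trans (cong (λ u → a₁ * d₁ - u) (*-zeroʳ b₁)) (+-identityʳ (a₁ * d₁)))) det≡1
  b₁-even : ∀ {u} → ∣ u ∣ ≡ 1 → Odd (b₁ + u) → ∃[ s ] b₁ ≡ s + s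
  b₁-even ∣u∣≡1 odd = even-half b₁ (neg-injective (trans (sym (negOnePow-+1 b₁))
    (trans (negOnePow-+-∣∣ b₁ 1ℤ b₁ _ refl (sym ∣u∣≡1)) odd)))
  𝔖[AB]≡𝔖B : 𝔖 (mat a₁ b₁ 0ℤ d₁ ⊗ B) ≡ 𝔖 B
  𝔖[AB]≡𝔖B with unit-product a₁ d₁ a₁d₁≡1
  ... | inj₁ (refl , refl) with b₁-even refl odd-col₂
  ...   | s , refl = 𝔖-translation-⊗ s B
  𝔖[AB]≡𝔖B | inj₂ (refl , refl) with b₁-even refl odd-col₂
  ...   | s , refl = 𝔖-neg-translation-⊗ s B

reduce-column : ∀ x y → y ≢ 0ℤ → Odd (x + y) → ∃[ t ] ∣ x + t * (y + y) ∣ ℕ.< ∣ y ∣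
reduce-column x (+ zero)  y≢0 _   = ⊥-elim (y≢0 refl)
reduce-column x (+ suc k) _   odd with near-even-multiple x k x≢N[2N]
  where
  x≢N[2N] : ∀ q → x ≢ + suc k + q * (+ suc k + + suc k)
  x≢N[2N] q refl = double-not-odd (sucℤ q * + suc k) (subst Odd (regroup q (+ suc k)) odd)
    where
    regroup : ∀ q n → n + q * (n + n) + n ≡ (1ℤ + q) * n + (1ℤ + q) * n
    regroup = solve-∀
... | q , lt = - q , subst (λ z → ∣ z ∣ ℕ.< suc k) (negate x q (+ suc k)) lt
  where
  negate : ∀ x q n → x - q * (n + n) ≡ x + - q * (n + n)
  negate = solve-∀
reduce-column x -[1+ k ]  _   odd with near-even-multiple x k x≢N[2N]
  where
  x≢N[2N] : ∀ q → x ≢ + suc k + q * (+ suc k + + suc k)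
  x≢N[2N] q refl = double-not-odd (q * + suc k) (subst Odd (regroup q (+ suc k)) odd)
    where
    regroup : ∀ q n → n + q * (n + n) + - n ≡ q * n + q * n
    regroup = solve-∀
... | q , lt = q , subst (λ z → ∣ z ∣ ℕ.< suc k) (negate x q (+ suc k)) lt
  where
  negate : ∀ x q n → x - q * (n + n) ≡ x + q * (- n + - n)
  negate = solve-∀

cocycle-descent : ∀ n A → ∣ c A ∣ ℕ.< n → OddColumns A → ∀ B → OddColumns B → Cocycle A B
cocycle-descent (suc n) A@(mat a₁ b₁ c₁ d₁) ∣c₁∣<1+n θA B θB with c₁ ≟ 0ℤ
... | yes refl = cocycle-upper a₁ b₁ d₁ B θA
... | no c₁≢0 with reduce-column a₁ c₁ c₁≢0 (OddColumns.odd-col₁ θA)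
...   | t , ∣a′∣<∣c₁∣ =
  cocycle-shift t A B (cocycle-rotate A′ B θA′ θB
    (cocycle-descent n (rotate A′) ∣-a′∣<n (oddColumns-rotate A′ θA′) B θB))
  where
  A′ = shift t A
  θA′ = oddColumns-shift t A θA
  ∣-a′∣<n : ∣ - a A′ ∣ ℕ.< n
  ∣-a′∣<n = subst (ℕ._< n) (sym (∣-i∣≡∣i∣ (a A′))) (ℕₚ.<-≤-trans ∣a′∣<∣c₁∣ (ℕₚ.≤-pred ∣c₁∣<1+n))

theorem6 : (A B : M2) → InΓθ A → InΓθ B →
    𝔖 (A ⊗ B) - 𝔖 A - 𝔖 B ≡ - sgn (c A * c B * c (A ⊗ B))
theorem6 A B A∈Γθ B∈Γθ =
  cocycle-descent (suc ∣ c A ∣) A ℕₚ.≤-refl (inΓθ⇒oddColumns A A∈Γθ) B (inΓθ⇒oddColumns B B∈Γθ)
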